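{- For all $\epsilon>0$ there is some $c=c(\epsilon)>0$ such that every CNF formula $\psi$ has some integer $d\in[1,c]$ with \[ \bigl|\psi^{[d,\epsilon^{ -4}d]}\bigr| \le \epsilon\cdot|\psi|. \]
   Context: A CNF formula $\psi$ is a set of clauses (ORs of literals); $|\psi|$ denotes its number of clauses and $|C|$ the number of literals of a clause $C$. For reals $a\le b$, $\psi^{[a,b]}=\{C\in\psi : a\le |C|\le b\}$.
   Formalization: The parameter ε ranges over the positive rationals. -}

module Defs where

open import Data.Nat as ℕ using (ℕ)
open import Data.Bool using (Bool; true; false; _∧_)
open import Data.Product using (_×_)
open import Data.List using (List; []; _∷_; length)
open import Data.List.Relation.Unary.Unique.Propositional using (Unique)
open import Data.List.Relation.Unary.All using (All)
open import Data.List.Relation.Unary.AllPairs using (AllPairs)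
open import Data.List.Relation.Binary.Permutation.Propositional using (_↭_)
open import Data.Integer as ℤ using ()
open import Data.Rational as ℚ using (ℚ; _≤ᵇ_; _*_)
open import Relation.Nullary using (¬_; does)

-- A literal: a variable index together with a polarity
-- (true = positive literal x_i, false = negated literal ¬x_i).
Literal : Set
Literal = ℕ × Bool

-- A clause is a finite set of literals, represented as a duplicate-free list.
Clause : Set
Clause = List Literal

IsClause : Clause → Set
IsClause C = Unique C

-- A CNF formula is a finite set of clauses: a list of clauses, each itself
-- duplicate-free, with no two entries equal as sets (i.e. permutations).
CNF : Set
CNF = List Clause

IsCNF : CNF → Set
IsCNF ψ = All IsClause ψ × AllPairs (λ C D → ¬ (C ↭ D)) ψ

size : Clause → ℕ
size = length

toℚ : ℕ → ℚ
toℚ n = (ℤ.+ n) ℚ./ 1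

-- Is  a ≤ |C| ≤ ε⁻⁴ · d  with a = d ?  The upper bound |C| ≤ ε⁻⁴ d is
-- written equivalently (ε > 0) as  ε⁴ · |C| ≤ d.
inWindow : ℚ → ℕ → Clause → Bool
inWindow ε d C = does (d ℕ.≤? size C) ∧ ((ε * ε * ε * ε * toℚ (size C)) ≤ᵇ toℚ d)

countWindow : ℚ → ℕ → CNF → ℕ
countWindow ε d [] = 0
countWindow ε d (C ∷ ψ) with inWindow ε d C
... | true  = ℕ.suc (countWindow ε d ψ)
... | false = countWindow ε d ψ

-- The proof is an averaging argument over disjoint windows.  Choose K ∈ ℕ with
-- ε⁴·K ≥ 1 and define scales d₀ = 1, d_{i+1} = K·(d_i + 1).  Then
-- ε⁴·d_{i+1} > d_i, so a clause of size s lying in the window of d_i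
-- (d_i ≤ s ≤ ε⁻⁴ d_i) cannot lie in the window of any later d_j (which would
-- force s ≥ d_j ≥ d_{i+1} > ε⁻⁴ d_i): the windows are pairwise disjoint.
-- Taking M + 1 scales with ε·(M + 1) ≥ 1, the window counts sum to at most |ψ|,
-- so the smallest of them is at most |ψ| / (M + 1) ≤ ε·|ψ|; and c = d_M.
module Submission where

open import Defs
open import Data.Nat as ℕ using (ℕ; zero; suc; z≤n; s≤s)
import Data.Nat.Properties as ℕP
open import Data.Integer as ℤ using (+_; +[1+_]; -[1+_])
import Data.Integer.Properties as ℤP
open import Data.Rational as ℚ using (ℚ; mkℚ; _<_; _≤_; _*_; 0ℚ; 1ℚ; Positive; NonNegative)
import Data.Rational.Properties as ℚP
import Data.Rational.Unnormalised as ℚᵘ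
import Data.Rational.Unnormalised.Properties as ℚᵘP
open import Data.Nat.Coprimality using (1-coprimeTo) renaming (sym to coprime-sym)
open import Algebra.Properties.CommutativeSemigroup ℕP.+-commutativeSemigroup using (interchange)
open import Relation.Binary.PropositionalEquality
open import Data.Product using (Σ; _×_; _,_; proj₁; proj₂)
open import Data.Bool using (Bool; true; false; T)
open import Data.Bool.Properties using (T-∧; T-≡)
open import Data.List using (List; []; _∷_; length)
open import Data.Sum using (inj₁; inj₂; [_,_]′)
open import Data.Empty using (⊥; ⊥-elim)
open import Function.Bundles using (Equivalence)
open import Relation.Nullary using (yes; no)

toℚ-normal : ∀ n → toℚ n ≡ mkℚ (+ n) 0 (coprime-sym (1-coprimeTo n))
toℚ-normal n = ℚP.normalize-coprime {n} {0} (coprime-sym (1-coprimeTo n))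

toℚ-mono-≤ : ∀ {m n} → m ℕ.≤ n → toℚ m ≤ toℚ n
toℚ-mono-≤ {m} {n} m≤n rewrite toℚ-normal m | toℚ-normal n =
  ℚ.*≤* (ℤP.*-monoʳ-≤-nonNeg (+ 1) (ℤ.+≤+ m≤n))

toℚ-mono-< : ∀ {m n} → m ℕ.< n → toℚ m < toℚ n
toℚ-mono-< {m} {n} m<n rewrite toℚ-normal m | toℚ-normal n =
  ℚ.*<* (ℤP.*-monoʳ-<-pos (+ 1) (ℤ.+<+ m<n))

toℚ-nonNeg : ∀ n → NonNegative (toℚ n)
toℚ-nonNeg n = ℚ.nonNegative {toℚ n} (toℚ-mono-≤ {0} {n} z≤n)

toℚ-* : ∀ m n → toℚ (m ℕ.* n) ≡ toℚ m * toℚ n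
toℚ-* m n = ℚP.toℚᵘ-injective
  (ℚᵘP.≃-trans homo (ℚᵘP.≃-sym (ℚP.toℚᵘ-homo-* (toℚ m) (toℚ n))))
  where
  homo : ℚ.toℚᵘ (toℚ (m ℕ.* n)) ℚᵘ.≃ (ℚ.toℚᵘ (toℚ m) ℚᵘ.* ℚ.toℚᵘ (toℚ n))
  homo rewrite toℚ-normal m | toℚ-normal n | toℚ-normal (m ℕ.* n) =
    ℚᵘ.*≡* (cong (ℤ._* + 1) (ℤP.pos-* m n))

-- Archimedean property: a positive rational times a large enough natural
-- number is at least 1.  For x = (k+1)/(b+1) the factor b + 1 suffices.
archimedean : ∀ x → 0ℚ < x → Σ ℕ (λ n → 1ℚ ≤ x * toℚ (suc n))
archimedean x@(mkℚ +[1+ k ] b _) _ =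
  b , ℚP.toℚᵘ-cancel-≤ (ℚᵘP.≤-respʳ-≃ (ℚᵘP.≃-sym (ℚP.toℚᵘ-homo-* x (toℚ (suc b)))) one≤)
  where
  -- In cross-multiplied form the claim is  b + 1 ≤ (k + 1)·(b + 1).
  one≤ : ℚᵘ.1ℚᵘ ℚᵘ.≤ (ℚ.toℚᵘ x ℚᵘ.* ℚ.toℚᵘ (toℚ (suc b)))
  one≤ rewrite toℚ-normal (suc b) = ℚᵘ.*≤* (ℤ.+≤+ (s≤s (subst₂ ℕ._≤_
    (sym (trans (ℕP.+-identityʳ _) (ℕP.*-identityʳ b)))
    (sym (ℕP.*-identityʳ _))
    (ℕP.m≤m+n b _))))
archimedean (mkℚ (+ zero) _ _) (ℚ.*<* (ℤ.+<+ ()))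
archimedean (mkℚ -[1+ _ ] _ _) (ℚ.*<* ())

fraction-≤ : ∀ x .{{_ : NonNegative x}} K a L → 1ℚ ≤ x * toℚ K → K ℕ.* a ℕ.≤ L →
             toℚ a ≤ x * toℚ L
fraction-≤ x K a L 1≤xK Ka≤L = begin
    toℚ a                  ≡⟨ sym (ℚP.*-identityˡ _) ⟩
    1ℚ * toℚ a             ≤⟨ ℚP.*-monoʳ-≤-nonNeg (toℚ a) {{toℚ-nonNeg a}} 1≤xK ⟩
    x * toℚ K * toℚ a      ≡⟨ ℚP.*-assoc x _ _ ⟩
    x * (toℚ K * toℚ a)    ≡⟨ cong (x *_) (sym (toℚ-* K a)) ⟩
    x * toℚ (K ℕ.* a)      ≤⟨ ℚP.*-monoˡ-≤-nonNeg x (toℚ-mono-≤ Ka≤L) ⟩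
    x * toℚ L              ∎
  where open ℚP.≤-Reasoning

Sum : ℕ → (ℕ → ℕ) → ℕ
Sum zero    f = 0
Sum (suc M) f = Sum M f ℕ.+ f M

Sum-+ : ∀ M f g → Sum M (λ i → f i ℕ.+ g i) ≡ Sum M f ℕ.+ Sum M g
Sum-+ zero    f g = refl
Sum-+ (suc M) f g =
  trans (cong (ℕ._+ (f M ℕ.+ g M)) (Sum-+ M f g)) (interchange (Sum M f) (Sum M g) (f M) (g M))

Sum-zero : ∀ M → Sum M (λ _ → 0) ≡ 0
Sum-zero zero    = refl
Sum-zero (suc M) = cong (ℕ._+ 0) (Sum-zero M)

Sum-lower : ∀ M f k → (∀ j → j ℕ.< M → k ℕ.≤ f j) → M ℕ.* k ℕ.≤ Sum M f
Sum-lower zero    f k k≤f = z≤n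
Sum-lower (suc M) f k k≤f = subst (ℕ._≤ Sum M f ℕ.+ f M) (ℕP.+-comm (M ℕ.* k) k)
  (ℕP.+-mono-≤ (Sum-lower M f k (λ j j<M → k≤f j (ℕP.m<n⇒m<1+n j<M))) (k≤f M (ℕP.n<1+n M)))

argmin : ∀ M (f : ℕ → ℕ) → Σ ℕ (λ i → i ℕ.< suc M × (∀ j → j ℕ.< suc M → f i ℕ.≤ f j))
argmin zero f = 0 , s≤s z≤n , λ { zero _ → ℕP.≤-refl ; (suc j) (s≤s ()) }
argmin (suc M) f with argmin M f
... | i , i<1+M , fi≤ with f i ℕ.≤? f (suc M)
...   | yes fi≤fM = i , ℕP.m<n⇒m<1+n i<1+M , λ j j<2+M →
          [ fi≤ j , (λ { refl → fi≤fM }) ]′ (ℕP.m≤n⇒m<n∨m≡n (ℕP.≤-pred j<2+M))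
...   | no  fi≰fM = suc M , ℕP.n<1+n (suc M) , λ j j<2+M →
          [ (λ j<1+M → ℕP.≤-trans (ℕP.<⇒≤ (ℕP.≰⇒> fi≰fM)) (fi≤ j j<1+M)) , (λ { refl → ℕP.≤-refl }) ]′
            (ℕP.m≤n⇒m<n∨m≡n (ℕP.≤-pred j<2+M))

pigeonhole : ∀ M (f : ℕ → ℕ) → Σ ℕ (λ i → i ℕ.< suc M × suc M ℕ.* f i ℕ.≤ Sum (suc M) f)
pigeonhole M f with argmin M f
... | i , i<1+M , fi≤ = i , i<1+M , Sum-lower (suc M) f (f i) fi≤

module _ {A : Set} where

  fromBool : Bool → ℕ
  fromBool true  = 1
  fromBool false = 0

  count : (A → Bool) → List A → ℕ
  count p []       = 0
  count p (x ∷ xs) = fromBool (p x) ℕ.+ count p xs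

  Disjoint : (ℕ → A → Bool) → Set
  Disjoint W = ∀ i j x → i ℕ.< j → W i x ≡ true → W j x ≡ true → ⊥

  module _ {W : ℕ → A → Bool} (disjoint : Disjoint W) where

    earlier-windows-miss : ∀ {M x} N → N ℕ.≤ M → W M x ≡ true →
                           Sum N (λ i → fromBool (W i x)) ≡ 0
    earlier-windows-miss zero    _     _    = refl
    earlier-windows-miss {M} {x} (suc N) 1+N≤M in-M with W N x in in-N
    ... | true  = ⊥-elim (disjoint N M x 1+N≤M in-N in-M)
    ... | false = trans (ℕP.+-identityʳ _) (earlier-windows-miss N (ℕP.<⇒≤ 1+N≤M) in-M)

    at-most-one-window : ∀ M x → Sum M (λ i → fromBool (W i x)) ℕ.≤ 1
    at-most-one-window zero    x = z≤n
    at-most-one-window (suc M) x with W M x in in-M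
    ... | false = subst (ℕ._≤ 1) (sym (ℕP.+-identityʳ _)) (at-most-one-window M x)
    ... | true  = ℕP.≤-reflexive (cong (ℕ._+ 1) (earlier-windows-miss M ℕP.≤-refl in-M))

    windows-total : ∀ M xs → Sum M (λ i → count (W i) xs) ℕ.≤ length xs
    windows-total M []       = ℕP.≤-reflexive (Sum-zero M)
    windows-total M (x ∷ xs) = begin
        Sum M (λ i → fromBool (W i x) ℕ.+ count (W i) xs)          ≡⟨ Sum-+ M _ _ ⟩
        Sum M (λ i → fromBool (W i x)) ℕ.+ Sum M (λ i → count (W i) xs)
          ≤⟨ ℕP.+-mono-≤ (at-most-one-window M x) (windows-total M xs) ⟩
        suc (length xs)                                              ∎
      where open ℕP.≤-Reasoning

    sparse-window : ∀ M xs → Σ ℕ (λ i → i ℕ.< suc M × suc M ℕ.* count (W i) xs ℕ.≤ length xs)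
    sparse-window M xs with pigeonhole M (λ i → count (W i) xs)
    ... | i , i<1+M , bound = i , i<1+M , ℕP.≤-trans bound (windows-total (suc M) xs)

countWindow-count : ∀ ε d ψ → countWindow ε d ψ ≡ count (inWindow ε d) ψ
countWindow-count ε d []      = refl
countWindow-count ε d (C ∷ ψ) with inWindow ε d C
... | true  = cong suc (countWindow-count ε d ψ)
... | false = countWindow-count ε d ψ

module _ {ε d C} (in-window : inWindow ε d C ≡ true) where

  private
    bounds : T (d ℕ.≤ᵇ size C) × T (ε * ε * ε * ε * toℚ (size C) ℚ.≤ᵇ toℚ d)
    bounds = Equivalence.to (T-∧ {d ℕ.≤ᵇ size C}) (Equivalence.from T-≡ in-window)

  window-lower : d ℕ.≤ size C
  window-lower = ℕP.≤ᵇ⇒≤ d (size C) (proj₁ bounds)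

  window-upper : ε * ε * ε * ε * toℚ (size C) ≤ toℚ d
  window-upper = ℚP.≤ᵇ⇒≤ (proj₂ bounds)

module Scales (ε : ℚ) (ε>0 : 0ℚ < ε) where

  ε⁴ : ℚ
  ε⁴ = ε * ε * ε * ε

  instance
    ε-pos : Positive ε
    ε-pos = ℚ.positive ε>0

    ε-nonNeg : NonNegative ε
    ε-nonNeg = ℚP.pos⇒nonNeg ε

    ε⁴-pos : Positive ε⁴
    ε⁴-pos = ℚP.pos*pos⇒pos (ε * ε * ε) {{ℚP.pos*pos⇒pos (ε * ε) {{ℚP.pos*pos⇒pos ε ε}} ε}} ε

    ε⁴-nonNeg : NonNegative ε⁴
    ε⁴-nonNeg = ℚP.pos⇒nonNeg ε⁴

  K : ℕ
  K = suc (proj₁ (archimedean ε⁴ (ℚP.positive⁻¹ ε⁴)))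

  ε⁴K≥1 : 1ℚ ≤ ε⁴ * toℚ K
  ε⁴K≥1 = proj₂ (archimedean ε⁴ (ℚP.positive⁻¹ ε⁴))

  scale : ℕ → ℕ
  scale zero    = 1
  scale (suc i) = K ℕ.* suc (scale i)

  scale-pos : ∀ i → 1 ℕ.≤ scale i
  scale-pos zero    = s≤s z≤n
  scale-pos (suc i) = s≤s z≤n

  scale-mono : ∀ {i j} → i ℕ.≤ j → scale i ℕ.≤ scale j
  scale-mono {j = zero}  z≤n  = ℕP.≤-refl
  scale-mono {i} {suc j} i≤1+j with ℕP.m≤n⇒m<n∨m≡n i≤1+j
  ... | inj₂ refl     = ℕP.≤-refl
  ... | inj₁ (s≤s i≤j) = ℕP.≤-trans (scale-mono i≤j)
                                   (ℕP.≤-trans (ℕP.n≤1+n (scale j)) (ℕP.m≤n*m (suc (scale j)) K))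

  scale-separated : ∀ i → toℚ (scale i) < ε⁴ * toℚ (scale (suc i))
  scale-separated i = ℚP.<-≤-trans (toℚ-mono-< (ℕP.n<1+n (scale i)))
                                    (fraction-≤ ε⁴ K (suc (scale i)) (scale (suc i)) ε⁴K≥1 ℕP.≤-refl)

  -- Hence the windows [d_i, ε⁻⁴ d_i] are pairwise disjoint: a clause in the
  -- windows of d_i and d_j (i < j) would have  ε⁴·d_{i+1} ≤ ε⁴·|C| ≤ d_i.
  windows-disjoint : Disjoint (λ i → inWindow ε (scale i))
  windows-disjoint i j C i<j in-i in-j =
    ℚP.<-irrefl refl (ℚP.<-≤-trans (scale-separated i) (begin
      ε⁴ * toℚ (scale (suc i))  ≤⟨ ℚP.*-monoˡ-≤-nonNeg ε⁴ (toℚ-mono-≤ next-scale≤size) ⟩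
      ε⁴ * toℚ (size C)         ≤⟨ window-upper {ε} {scale i} {C} in-i ⟩
      toℚ (scale i)             ∎))
    where
    open ℚP.≤-Reasoning
    next-scale≤size : scale (suc i) ℕ.≤ size C
    next-scale≤size = ℕP.≤-trans (scale-mono i<j) (window-lower {ε} {scale j} {C} in-j)

corollary1 : (ε : ℚ) → 0ℚ < ε →
    Σ ℕ (λ c → 0 ℕ.< c × ((ψ : CNF) → IsCNF ψ →
    Σ ℕ (λ d → 1 ℕ.≤ d × d ℕ.≤ c ×
    toℚ (countWindow ε d ψ) ≤ ε * toℚ (length ψ))))
corollary1 ε ε>0 = scale M , scale-pos M , λ ψ _ → sparse-scale ψ
  where
  open Scales ε ε>0

  M : ℕ
  M = proj₁ (archimedean ε ε>0)

  sparse-scale : (ψ : CNF) → Σ ℕ (λ d → 1 ℕ.≤ d × d ℕ.≤ scale M ×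
                   toℚ (countWindow ε d ψ) ≤ ε * toℚ (length ψ))
  sparse-scale ψ =
    let (i , i<1+M , few) = sparse-window {W = λ i → inWindow ε (scale i)} windows-disjoint M ψ
    in scale i , scale-pos i , scale-mono (ℕP.≤-pred i<1+M) ,
       subst (λ n → toℚ n ≤ ε * toℚ (length ψ)) (sym (countWindow-count ε (scale i) ψ))
         (fraction-≤ ε (suc M) _ (length ψ) (proj₂ (archimedean ε ε>0)) few)
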